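{- Let $a,b,p,q$ be complex numbers with $p\neq 0$, $q\neq 0$, and let $(W_j)$, $(V_j)$ be as defined in the context. If $n$ is a non-negative integer and $r$ and $t$ are any integers, then \[ \sum_{k = 0}^n \binom nk^3 q^{rk} W_{r(n - 2k) + t} = W_t \sum_{k = 0}^n \binom{n + k}{2k}\binom{2k}{k}\binom{n - k}{k}q^{rk} V_r^{n - 2k}. \]
   Context: The Horadam sequence $W_j=W_j(a,b;p,q)$ is defined by $W_0=a$, $W_1=b$, $W_j=pW_{j-1}-qW_{j-2}$ for $j\ge 2$, and extended to negative indices by $W_{ -j}=\frac{1}{q}(pW_{ -j+1}-W_{ -j+2})$. The Lucas sequence of the second kind is $V_j=W_j(2,p;p,q)$ (so $V_0=2$, $V_1=p$). Binomial coefficients $\binom{N}{k}$ with $k>N\ge 0$ are $0$. -}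

module Defs where

open import Level using (Level)
open import Algebra.Bundles using (CommutativeRing)
open import Data.Nat as ℕ using (ℕ; zero; suc; _∸_)
open import Data.Nat.Combinatorics using (_C_)
open import Data.Integer as ℤ using (ℤ; +_; -[1+_])
open import Data.Product using (_×_; _,_; proj₁; proj₂)

module Horadam {c ℓ : Level} (R : CommutativeRing c ℓ) where
  open CommutativeRing R hiding (zero)

  pow : Carrier → ℕ → Carrier
  pow x zero    = 1#
  pow x (suc n) = x * pow x n

  zpow : Carrier → Carrier → ℤ → Carrier
  zpow x xinv (+ n)     = pow x n
  zpow x xinv -[1+ n ]  = pow xinv (suc n)

  fromℕ : ℕ → Carrier
  fromℕ zero    = 0#
  fromℕ (suc n) = 1# + fromℕ n

  -- (W_j , W_{j+1}) for j ≥ 0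
  Wpair : (a b p q : Carrier) → ℕ → Carrier × Carrier
  Wpair a b p q zero    = a , b
  Wpair a b p q (suc j) =
    let (x , y) = Wpair a b p q j in y , (p * y - q * x)

  -- (W_{-j} , W_{-j+1}) for j ≥ 0, using W_{-j} = qinv (p W_{-j+1} - W_{-j+2})
  Wnegpair : (a b p q qinv : Carrier) → ℕ → Carrier × Carrier
  Wnegpair a b p q qinv zero    = a , b
  Wnegpair a b p q qinv (suc j) =
    let (x , y) = Wnegpair a b p q qinv j in qinv * (p * x - y) , x

  -- Horadam sequence W_j(a,b;p,q), j ∈ ℤ, qinv the inverse of q
  W : (a b p q qinv : Carrier) → ℤ → Carrier
  W a b p q qinv (+ n)     = proj₁ (Wpair a b p q n)
  W a b p q qinv -[1+ n ]  = proj₁ (Wnegpair a b p q qinv (suc n))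

  V : (p q qinv : Carrier) → ℤ → Carrier
  V p q qinv = W (1# + 1#) p p q qinv

  sumTo : ℕ → (ℕ → Carrier) → Carrier
  sumTo zero    f = f zero
  sumTo (suc n) f = sumTo n f + f (suc n)

{-# OPTIONS --safe #-}

-- Put Q = q^r and H(i, j) = Q^j W_{r(i-j)+t}.  The identity W_{m+r} + q^r W_{m-r} = V_r W_m says
-- that multiplication by V_r acts on H as the sum of the two commuting unit shifts in i and j, so
-- V_r^s Q^j W_t = V_r^s H(j, j) = Σ_l C(s,l) H(j+s-l, j+l).  With s = n - 2j this expands every
-- term of the right-hand side in the H(n-k, k) = Q^k W_{r(n-2k)+t}, and comparing coefficients
-- leaves Σ_j C(n+j,2j) C(2j,j) C(n-j,j) C(n-2j,k-j) = C(n,k)^3.  Regrouping the products of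
-- binomials turns the left side into C(n,k) Σ_j C(n+j,j) C(k,j) C(n-k,j), and the last sum is
-- C(n,k)^2 by two applications of Vandermonde's convolution.
module Submission where

open import Defs
open import Level using (Level)
open import Algebra.Bundles using (CommutativeRing)
open import Data.Nat as ℕ using (ℕ; zero; suc; _∸_)
open import Data.Nat.Combinatorics using (_C_)
open import Data.Integer as ℤ using (ℤ; +_; -[1+_])
open import Relation.Nullary using (¬_)

module NatFacts where
  open import Data.Nat.Base
  open import Data.Nat.Properties
  open import Data.Nat.Combinatorics
  open import Data.Nat.DivMod using (m/n*n≡m)
  open import Data.Nat.Tactic.RingSolver using (solve-∀)
  open import Relation.Nullary.Decidable using (yes; no)
  open import Relation.Binary.PropositionalEquality
  open ≡-Reasoning

  nCk*k!*[n∸k]!≡n! : ∀ {n k} → k ≤ n → (n C k) * (k ! * (n ∸ k) !) ≡ n !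
  nCk*k!*[n∸k]!≡n! {n} {k} k≤n = begin
    (n C k) * (k ! * (n ∸ k) !)                    ≡⟨ cong (_* (k ! * (n ∸ k) !)) (nCk≡n!/k![n-k]! k≤n) ⟩
    (n ! / (k ! * (n ∸ k) !)) * (k ! * (n ∸ k) !)  ≡⟨ m/n*n≡m (k![n∸k]!∣n! k≤n) ⟩
    n ! ∎
    where instance _ = k !* (n ∸ k) !≢0

  nC[i+l]*[i+l]Ci≡nCi*[n∸i]Cl : ∀ n i l → (n C (i + l)) * ((i + l) C i) ≡ (n C i) * ((n ∸ i) C l)
  nC[i+l]*[i+l]Ci≡nCi*[n∸i]Cl n i l with i + l ≤? n
  ... | yes i+l≤n = *-cancelʳ-≡ _ _ (i ! * (l ! * d !)) {{i!l!d!≢0}} (trans lhs (sym rhs))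
    where
    d : ℕ
    d = n ∸ (i + l)
    instance
      i!l!d!≢0 : NonZero (i ! * (l ! * d !))
      i!l!d!≢0 = m*n≢0 (i !) (l ! * d !) {{i !≢0}} {{m*n≢0 (l !) (d !) {{l !≢0}} {{d !≢0}}}}
    reorderˡ : ∀ a b x y z → a * b * (x * (y * z)) ≡ a * (b * (x * y) * z)
    reorderˡ = solve-∀
    reorderʳ : ∀ a b x y z → a * b * (x * (y * z)) ≡ a * (x * (b * (y * z)))
    reorderʳ = solve-∀
    lhs : (n C (i + l)) * ((i + l) C i) * (i ! * (l ! * d !)) ≡ n !
    lhs = begin
      (n C (i + l)) * ((i + l) C i) * (i ! * (l ! * d !))   ≡⟨ reorderˡ (n C (i + l)) ((i + l) C i) (i !) (l !) (d !) ⟩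
      (n C (i + l)) * (((i + l) C i) * (i ! * l !) * d !)   ≡⟨ cong (λ x → (n C (i + l)) * (((i + l) C i) * (i ! * x !) * d !)) (m+n∸m≡n i l) ⟨
      (n C (i + l)) * (((i + l) C i) * (i ! * (i + l ∸ i) !) * d !)
        ≡⟨ cong (λ x → (n C (i + l)) * (x * d !)) (nCk*k!*[n∸k]!≡n! (m≤m+n i l)) ⟩
      (n C (i + l)) * ((i + l) ! * d !)                     ≡⟨ nCk*k!*[n∸k]!≡n! i+l≤n ⟩
      n ! ∎
    rhs : (n C i) * ((n ∸ i) C l) * (i ! * (l ! * d !)) ≡ n !
    rhs = begin
      (n C i) * ((n ∸ i) C l) * (i ! * (l ! * d !))         ≡⟨ reorderʳ (n C i) ((n ∸ i) C l) (i !) (l !) (d !) ⟩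
      (n C i) * (i ! * (((n ∸ i) C l) * (l ! * d !)))       ≡⟨ cong (λ x → (n C i) * (i ! * (((n ∸ i) C l) * (l ! * x !)))) (∸-+-assoc n i l) ⟨
      (n C i) * (i ! * (((n ∸ i) C l) * (l ! * (n ∸ i ∸ l) !)))
        ≡⟨ cong (λ x → (n C i) * (i ! * x)) (nCk*k!*[n∸k]!≡n! l≤n∸i) ⟩
      (n C i) * (i ! * (n ∸ i) !)                           ≡⟨ nCk*k!*[n∸k]!≡n! (≤-trans (m≤m+n i l) i+l≤n) ⟩
      n ! ∎
      where
      l≤n∸i : l ≤ n ∸ i
      l≤n∸i = subst (_≤ n ∸ i) (m+n∸m≡n i l) (∸-monoˡ-≤ i i+l≤n)
  ... | no i+l≰n with i ≤? n
  ...   | no i≰n = trans (cong (_* ((i + l) C i)) (k>n⇒nCk≡0 (≰⇒> i+l≰n)))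
                         (sym (cong (_* ((n ∸ i) C l)) (k>n⇒nCk≡0 (≰⇒> i≰n))))
  ...   | yes i≤n = trans (cong (_* ((i + l) C i)) (k>n⇒nCk≡0 (≰⇒> i+l≰n)))
                          (sym (trans (cong ((n C i) *_) (k>n⇒nCk≡0 (≰⇒> l≰n∸i))) (*-zeroʳ (n C i))))
    where
    l≰n∸i : ¬ (l ≤ n ∸ i)
    l≰n∸i l≤n∸i = i+l≰n (subst (i + l ≤_) (m+[n∸m]≡n i≤n) (+-monoʳ-≤ i l≤n∸i))

  nCi*[n∸i]Cm≡nCm*[n∸m]Ci : ∀ n i m → (n C i) * ((n ∸ i) C m) ≡ (n C m) * ((n ∸ m) C i)
  nCi*[n∸i]Cm≡nCm*[n∸m]Ci n i m = begin
    (n C i) * ((n ∸ i) C m)            ≡⟨ nC[i+l]*[i+l]Ci≡nCi*[n∸i]Cl n i m ⟨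
    (n C (i + m)) * ((i + m) C i)      ≡⟨ cong₂ (λ x y → (n C x) * y) (+-comm i m) i+mCi≡m+iCm ⟩
    (n C (m + i)) * ((m + i) C m)      ≡⟨ nC[i+l]*[i+l]Ci≡nCi*[n∸i]Cl n m i ⟩
    (n C m) * ((n ∸ m) C i) ∎
    where
    i+mCi≡m+iCm : (i + m) C i ≡ (m + i) C m
    i+mCi≡m+iCm = trans (nCk≡nC[n∸k] (m≤m+n i m)) (cong₂ _C_ (+-comm i m) (m+n∸m≡n i m))

  nC[j+l]*[j+l]Cj*[n∸[j+l]]Cj≡nC[2j]*[2j]Cj*[n∸2j]Cl : ∀ n j l →
    (n C (j + l)) * ((j + l) C j) * ((n ∸ (j + l)) C j) ≡ (n C (2 * j)) * ((2 * j) C j) * ((n ∸ 2 * j) C l)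
  nC[j+l]*[j+l]Cj*[n∸[j+l]]Cj≡nC[2j]*[2j]Cj*[n∸2j]Cl n j l = begin
    (n C (j + l)) * ((j + l) C j) * ((n ∸ (j + l)) C j)  ≡⟨ cong (_* ((n ∸ (j + l)) C j)) (nC[i+l]*[i+l]Ci≡nCi*[n∸i]Cl n j l) ⟩
    (n C j) * ((n ∸ j) C l) * ((n ∸ (j + l)) C j)        ≡⟨ *-assoc (n C j) _ _ ⟩
    (n C j) * (((n ∸ j) C l) * ((n ∸ (j + l)) C j))      ≡⟨ cong (λ x → (n C j) * (((n ∸ j) C l) * (x C j))) (∸-+-assoc n j l) ⟨
    (n C j) * (((n ∸ j) C l) * ((n ∸ j ∸ l) C j))        ≡⟨ cong ((n C j) *_) (nCi*[n∸i]Cm≡nCm*[n∸m]Ci (n ∸ j) l j) ⟩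
    (n C j) * (((n ∸ j) C j) * ((n ∸ j ∸ j) C l))        ≡⟨ *-assoc (n C j) _ _ ⟨
    (n C j) * ((n ∸ j) C j) * ((n ∸ j ∸ j) C l)          ≡⟨ cong₂ _*_ (nC[i+l]*[i+l]Ci≡nCi*[n∸i]Cl n j j) (cong (_C l) (sym (∸-+-assoc n j j))) ⟨
    (n C (j + j)) * ((j + j) C j) * ((n ∸ (j + j)) C l)  ≡⟨ cong (λ x → (n C x) * (x C j) * ((n ∸ x) C l)) (2*j≡j+j j) ⟨
    (n C (2 * j)) * ((2 * j) C j) * ((n ∸ 2 * j) C l) ∎
    where
    2*j≡j+j : ∀ j → 2 * j ≡ j + j
    2*j≡j+j = solve-∀

  [n+j]Cj*nC[2j]≡[n+j]C[2j]*[n∸j]Cj : ∀ n j → ((n + j) C j) * (n C (2 * j)) ≡ ((n + j) C (2 * j)) * ((n ∸ j) C j)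
  [n+j]Cj*nC[2j]≡[n+j]C[2j]*[n∸j]Cj n j = begin
    ((n + j) C j) * (n C (2 * j))                  ≡⟨ cong (λ x → ((n + j) C j) * (x C (2 * j))) (m+n∸n≡m n j) ⟨
    ((n + j) C j) * ((n + j ∸ j) C (2 * j))        ≡⟨ nCi*[n∸i]Cm≡nCm*[n∸m]Ci (n + j) j (2 * j) ⟩
    ((n + j) C (2 * j)) * ((n + j ∸ 2 * j) C j)    ≡⟨ cong (λ x → ((n + j) C (2 * j)) * (x C j)) (n+j∸2j≡n∸j n j) ⟩
    ((n + j) C (2 * j)) * ((n ∸ j) C j) ∎
    where
    n+j∸2j≡n∸j : ∀ n j → n + j ∸ 2 * j ≡ n ∸ j
    n+j∸2j≡n∸j n j = trans (sym (∸-+-assoc (n + j) j (j + 0))) (cong₂ _∸_ (m+n∸n≡m n j) (+-identityʳ j))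

  n∸[j+l]≡j+[n∸2j∸l] : ∀ {n j l} → 2 * j ≤ n → l ≤ n ∸ 2 * j → n ∸ (j + l) ≡ j + (n ∸ 2 * j ∸ l)
  n∸[j+l]≡j+[n∸2j∸l] {n} {j} {l} 2j≤n l≤s = begin
    n ∸ (j + l)                        ≡⟨ ∸-+-assoc n j l ⟨
    n ∸ j ∸ l                          ≡⟨ cong (λ x → x ∸ j ∸ l) (m+[n∸m]≡n 2j≤n) ⟨
    (j + (j + 0) + s) ∸ j ∸ l          ≡⟨ cong (λ x → x ∸ j ∸ l) (+-assoc j (j + 0) s) ⟩
    (j + ((j + 0) + s)) ∸ j ∸ l        ≡⟨ cong (_∸ l) (m+n∸m≡n j ((j + 0) + s)) ⟩
    (j + 0) + s ∸ l                    ≡⟨ cong (λ x → x + s ∸ l) (+-identityʳ j) ⟩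
    j + s ∸ l                          ≡⟨ +-∸-assoc j l≤s ⟩
    j + (s ∸ l)                        ∎
    where
    s : ℕ
    s = n ∸ 2 * j

  n<2j⇒n∸j<j : ∀ {n j} → n < 2 * j → n ∸ j < j
  n<2j⇒n∸j<j {n} {suc j} n<2j = m<n+o⇒m∸n<o n (suc j) (subst (n <_) (cong (λ x → suc j + x) (+-identityʳ (suc j))) n<2j)

module _ {c ℓ : Level} (R : CommutativeRing c ℓ) where
  open CommutativeRing R
  open Horadam R
  open import Algebra.Properties.Ring ring using (-‿distribˡ-*; -‿distribʳ-*)
  open import Algebra.Properties.AbelianGroup +-abelianGroup using (⁻¹-∙-comm; ⁻¹-involutive; ε⁻¹≈ε)
  open import Algebra.Properties.CommutativeSemigroup +-commutativeSemigroup using () renaming (interchange to +-interchange)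
  open import Algebra.Properties.CommutativeSemigroup *-commutativeSemigroup using () renaming (x∙yz≈y∙xz to x*[y*z]≈y*[x*z])
  open import Algebra.Definitions.RawMonoid +-rawMonoid using (_×_)
  open import Algebra.Properties.Monoid.Mult +-monoid using (×-homo-+)
  open import Algebra.Properties.Semiring.Mult semiring using (×1-homo-*)
  open import Relation.Binary.Reasoning.Setoid setoid
  open import Relation.Nullary.Decidable using (yes; no)
  open import Data.Integer.Tactic.RingSolver using (solve-∀)
  import Data.Integer.Properties as ℤ
  import Data.Nat.Properties as ℕ
  open import Data.Nat.Combinatorics using (k>n⇒nCk≡0; nCk+nC[k+1]≡[n+1]C[k+1]; nCk≡nC[n∸k])
  open NatFacts
  open import Relation.Binary.PropositionalEquality as ≡ using (_≡_)

  fromℕ≈×1# : ∀ n → fromℕ n ≈ n × 1#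
  fromℕ≈×1# zero    = refl
  fromℕ≈×1# (suc n) = +-congˡ (fromℕ≈×1# n)

  fromℕ-+ : ∀ m n → fromℕ (m ℕ.+ n) ≈ fromℕ m + fromℕ n
  fromℕ-+ m n = begin
    fromℕ (m ℕ.+ n)        ≈⟨ fromℕ≈×1# (m ℕ.+ n) ⟩
    (m ℕ.+ n) × 1#         ≈⟨ ×-homo-+ 1# m n ⟩
    m × 1# + n × 1#        ≈⟨ +-cong (fromℕ≈×1# m) (fromℕ≈×1# n) ⟨
    fromℕ m + fromℕ n      ∎

  fromℕ-* : ∀ m n → fromℕ (m ℕ.* n) ≈ fromℕ m * fromℕ n
  fromℕ-* m n = begin
    fromℕ (m ℕ.* n)        ≈⟨ fromℕ≈×1# (m ℕ.* n) ⟩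
    (m ℕ.* n) × 1#         ≈⟨ ×1-homo-* m n ⟩
    m × 1# * n × 1#        ≈⟨ *-cong (fromℕ≈×1# m) (fromℕ≈×1# n) ⟨
    fromℕ m * fromℕ n      ∎

  private
    fromℤ : ℤ → Carrier
    fromℤ (+ n)    = fromℕ n
    fromℤ -[1+ n ] = - fromℕ (suc n)

    fromℤ-neg : ∀ i → fromℤ (ℤ.- i) ≈ - fromℤ i
    fromℤ-neg -[1+ n ]  = sym (⁻¹-involutive _)
    fromℤ-neg (+ zero)  = sym ε⁻¹≈ε
    fromℤ-neg (+ suc n) = refl

    fromℤ-⊖ : ∀ m n → fromℤ (m ℤ.⊖ n) ≈ fromℕ m - fromℕ n
    fromℤ-⊖ zero    zero    = sym (-‿inverseʳ 0#)
    fromℤ-⊖ zero    (suc n) = sym (+-identityˡ _)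
    fromℤ-⊖ (suc m) zero    = sym (trans (+-congˡ ε⁻¹≈ε) (+-identityʳ _))
    fromℤ-⊖ (suc m) (suc n) = begin
      fromℤ (suc m ℤ.⊖ suc n)             ≡⟨ ≡.cong fromℤ (ℤ.[1+m]⊖[1+n]≡m⊖n m n) ⟩
      fromℤ (m ℤ.⊖ n)                     ≈⟨ fromℤ-⊖ m n ⟩
      fromℕ m - fromℕ n                   ≈⟨ +-identityˡ _ ⟨
      0# + (fromℕ m - fromℕ n)            ≈⟨ +-congʳ (-‿inverseʳ 1#) ⟨
      (1# - 1#) + (fromℕ m - fromℕ n)     ≈⟨ +-interchange 1# (- 1#) (fromℕ m) (- fromℕ n) ⟩
      (1# + fromℕ m) + (- 1# - fromℕ n)   ≈⟨ +-congˡ (⁻¹-∙-comm 1# (fromℕ n)) ⟩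
      (1# + fromℕ m) - (1# + fromℕ n)     ∎

    fromℤ-+ : ∀ i j → fromℤ (i ℤ.+ j) ≈ fromℤ i + fromℤ j
    fromℤ-+ -[1+ m ] -[1+ n ] = begin
      - fromℕ (suc (suc (m ℕ.+ n)))        ≡⟨ ≡.cong (λ z → - fromℕ z) (ℕ.+-suc (suc m) n) ⟨
      - fromℕ (suc m ℕ.+ suc n)            ≈⟨ -‿cong (fromℕ-+ (suc m) (suc n)) ⟩
      - (fromℕ (suc m) + fromℕ (suc n))    ≈⟨ ⁻¹-∙-comm _ _ ⟨
      - fromℕ (suc m) - fromℕ (suc n)      ∎
    fromℤ-+ -[1+ m ] (+ n)    = trans (fromℤ-⊖ n (suc m)) (+-comm _ _)
    fromℤ-+ (+ m)    -[1+ n ] = fromℤ-⊖ m (suc n)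
    fromℤ-+ (+ m)    (+ n)    = fromℕ-+ m n

    fromℤ-*⁺ : ∀ m j → fromℤ (+ m ℤ.* j) ≈ fromℕ m * fromℤ j
    fromℤ-*⁺ m (+ n)    = trans (reflexive (≡.cong fromℤ (≡.sym (ℤ.pos-* m n)))) (fromℕ-* m n)
    fromℤ-*⁺ m -[1+ n ] = begin
      fromℤ (+ m ℤ.* -[1+ n ])             ≡⟨ ≡.cong fromℤ (ℤ.neg-distribʳ-* (+ m) (+ suc n)) ⟨
      fromℤ (ℤ.- (+ m ℤ.* + suc n))        ≈⟨ fromℤ-neg (+ m ℤ.* + suc n) ⟩
      - fromℤ (+ m ℤ.* + suc n)            ≈⟨ -‿cong (fromℤ-*⁺ m (+ suc n)) ⟩
      - (fromℕ m * fromℕ (suc n))          ≈⟨ -‿distribʳ-* _ _ ⟩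
      fromℕ m * - fromℕ (suc n)            ∎

    fromℤ-* : ∀ i j → fromℤ (i ℤ.* j) ≈ fromℤ i * fromℤ j
    fromℤ-* (+ m)    j = fromℤ-*⁺ m j
    fromℤ-* -[1+ m ] j = begin
      fromℤ (-[1+ m ] ℤ.* j)               ≡⟨ ≡.cong fromℤ (ℤ.neg-distribˡ-* (+ suc m) j) ⟨
      fromℤ (ℤ.- (+ suc m ℤ.* j))          ≈⟨ fromℤ-neg (+ suc m ℤ.* j) ⟩
      - fromℤ (+ suc m ℤ.* j)              ≈⟨ -‿cong (fromℤ-*⁺ (suc m) j) ⟩
      - (fromℕ (suc m) * fromℤ j)          ≈⟨ -‿distribˡ-* _ _ ⟩
      - fromℕ (suc m) * fromℤ j            ∎

  -- Integer coefficients let the ring solver detect cancellations such as x - x ≈ 0.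
  private module IntegerCoefficientSolver where
    open import Algebra.Solver.Ring.AlmostCommutativeRing
      using (_-Raw-AlmostCommutative⟶_; fromCommutativeRing)
    open import Relation.Nullary.Decidable using (dec⇒maybe)
    open import Data.Maybe using (Maybe; map)

    fromℤ-morphism : CommutativeRing.rawRing ℤ.+-*-commutativeRing -Raw-AlmostCommutative⟶ fromCommutativeRing R
    fromℤ-morphism = record
      { ⟦_⟧ = fromℤ ; +-homo = fromℤ-+ ; *-homo = fromℤ-* ; -‿homo = fromℤ-neg
      ; 0-homo = refl ; 1-homo = +-identityʳ 1# }

    fromℤ-≟ : ∀ i j → Maybe (fromℤ i ≈ fromℤ j)
    fromℤ-≟ i j = map (λ i≡j → reflexive (≡.cong fromℤ i≡j)) (dec⇒maybe (i ℤ.≟ j))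

    open import Algebra.Solver.Ring (CommutativeRing.rawRing ℤ.+-*-commutativeRing) (fromCommutativeRing R) fromℤ-morphism fromℤ-≟ public

  open IntegerCoefficientSolver using (solve; _:+_; _:-_; _:*_; _:=_)

  sumTo-cong≤ : ∀ n {f g : ℕ → Carrier} → (∀ k → k ℕ.≤ n → f k ≈ g k) → sumTo n f ≈ sumTo n g
  sumTo-cong≤ zero    f≈g = f≈g 0 ℕ.z≤n
  sumTo-cong≤ (suc n) f≈g = +-cong (sumTo-cong≤ n (λ k k≤n → f≈g k (ℕ.m≤n⇒m≤1+n k≤n))) (f≈g (suc n) ℕ.≤-refl)

  sumTo-cong : ∀ n {f g : ℕ → Carrier} → (∀ k → f k ≈ g k) → sumTo n f ≈ sumTo n g
  sumTo-cong n f≈g = sumTo-cong≤ n (λ k _ → f≈g k)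

  sumTo-distrib-+ : ∀ n (f g : ℕ → Carrier) → sumTo n (λ k → f k + g k) ≈ sumTo n f + sumTo n g
  sumTo-distrib-+ zero    f g = refl
  sumTo-distrib-+ (suc n) f g = begin
    sumTo n (λ k → f k + g k) + (f (suc n) + g (suc n))   ≈⟨ +-congʳ (sumTo-distrib-+ n f g) ⟩
    (sumTo n f + sumTo n g) + (f (suc n) + g (suc n))     ≈⟨ +-interchange (sumTo n f) (sumTo n g) (f (suc n)) (g (suc n)) ⟩
    (sumTo n f + f (suc n)) + (sumTo n g + g (suc n))     ∎

  *-distribˡ-sumTo : ∀ n x (f : ℕ → Carrier) → x * sumTo n f ≈ sumTo n (λ k → x * f k)
  *-distribˡ-sumTo zero    x f = refl
  *-distribˡ-sumTo (suc n) x f = trans (distribˡ x _ _) (+-congʳ (*-distribˡ-sumTo n x f))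

  sumTo-unfoldˡ : ∀ n (f : ℕ → Carrier) → sumTo (suc n) f ≈ f 0 + sumTo n (λ k → f (suc k))
  sumTo-unfoldˡ zero    f = refl
  sumTo-unfoldˡ (suc n) f = trans (+-congʳ (sumTo-unfoldˡ n f)) (+-assoc _ _ _)

  sumTo-comm : ∀ m n (f : ℕ → ℕ → Carrier) →
               sumTo m (λ i → sumTo n (λ j → f i j)) ≈ sumTo n (λ j → sumTo m (λ i → f i j))
  sumTo-comm zero    n f = refl
  sumTo-comm (suc m) n f = trans (+-congʳ (sumTo-comm m n f))
                                 (sym (sumTo-distrib-+ n (λ j → sumTo m (λ i → f i j)) (f (suc m))))

  sumTo-dropˡ : ∀ j n (f : ℕ → Carrier) → (∀ k → k ℕ.< j → f k ≈ 0#) →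
                sumTo (j ℕ.+ n) f ≈ sumTo n (λ l → f (j ℕ.+ l))
  sumTo-dropˡ zero    n f _  = refl
  sumTo-dropˡ (suc j) n f f≈0 = begin
    sumTo (suc (j ℕ.+ n)) f                    ≈⟨ sumTo-unfoldˡ (j ℕ.+ n) f ⟩
    f 0 + sumTo (j ℕ.+ n) (λ k → f (suc k))    ≈⟨ +-cong (f≈0 0 ℕ.z<s) (sumTo-dropˡ j n (λ k → f (suc k)) (λ k k<j → f≈0 (suc k) (ℕ.s<s k<j))) ⟩
    0# + sumTo n (λ l → f (suc j ℕ.+ l))       ≈⟨ +-identityˡ _ ⟩
    sumTo n (λ l → f (suc j ℕ.+ l))            ∎

  sumTo-head : ∀ n (f : ℕ → Carrier) → (∀ k → f (suc k) ≈ 0#) → sumTo n f ≈ f 0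
  sumTo-head zero    f _   = refl
  sumTo-head (suc n) f f≈0 = trans (+-cong (sumTo-head n f f≈0) (f≈0 n)) (+-identityʳ _)

  infixl 10 _Cᴿ_
  _Cᴿ_ : ℕ → ℕ → Carrier
  n Cᴿ k = fromℕ (n C k)

  k>n⇒nCᴿk≈0 : ∀ {n k} → n ℕ.< k → n Cᴿ k ≈ 0#
  k>n⇒nCᴿk≈0 k>n = reflexive (≡.cong fromℕ (k>n⇒nCk≡0 k>n))

  nCᴿk+nCᴿ[k+1]≈[n+1]Cᴿ[k+1] : ∀ n k → n Cᴿ k + n Cᴿ suc k ≈ suc n Cᴿ suc k
  nCᴿk+nCᴿ[k+1]≈[n+1]Cᴿ[k+1] n k =
    trans (sym (fromℕ-+ (n C k) (n C suc k))) (reflexive (≡.cong fromℕ (nCk+nC[k+1]≡[n+1]C[k+1] n k)))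

  fromℕ-*-≡ : ∀ a b c d → a ℕ.* b ≡ c ℕ.* d → fromℕ a * fromℕ b ≈ fromℕ c * fromℕ d
  fromℕ-*-≡ a b c d eq = begin
    fromℕ a * fromℕ b    ≈⟨ fromℕ-* a b ⟨
    fromℕ (a ℕ.* b)      ≡⟨ ≡.cong fromℕ eq ⟩
    fromℕ (c ℕ.* d)      ≈⟨ fromℕ-* c d ⟩
    fromℕ c * fromℕ d    ∎

  fromℕ-*-*-≡ : ∀ a b c d e f → a ℕ.* b ℕ.* c ≡ d ℕ.* e ℕ.* f →
                fromℕ a * fromℕ b * fromℕ c ≈ fromℕ d * fromℕ e * fromℕ f
  fromℕ-*-*-≡ a b c d e f eq = begin
    fromℕ a * fromℕ b * fromℕ c    ≈⟨ *-congʳ (fromℕ-* a b) ⟨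
    fromℕ (a ℕ.* b) * fromℕ c      ≈⟨ fromℕ-*-≡ (a ℕ.* b) c (d ℕ.* e) f eq ⟩
    fromℕ (d ℕ.* e) * fromℕ f      ≈⟨ *-congʳ (fromℕ-* d e) ⟩
    fromℕ d * fromℕ e * fromℕ f    ∎

  x≈0⇒x*y≈0 : ∀ {x} y → x ≈ 0# → x * y ≈ 0#
  x≈0⇒x*y≈0 y x≈0 = trans (*-congʳ x≈0) (zeroˡ y)

  y≈0⇒x*y≈0 : ∀ x {y} → y ≈ 0# → x * y ≈ 0#
  y≈0⇒x*y≈0 x y≈0 = trans (*-congˡ y≈0) (zeroʳ x)

  x≈0⇒x*y≈x*z : ∀ {x} y z → x ≈ 0# → x * y ≈ x * z
  x≈0⇒x*y≈x*z y z x≈0 = trans (x≈0⇒x*y≈0 y x≈0) (sym (x≈0⇒x*y≈0 z x≈0))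

  vandermonde : ∀ a b c N → a ℕ.≤ N →
                sumTo N (λ j → a Cᴿ j * b Cᴿ (c ℕ.+ j)) ≈ (a ℕ.+ b) Cᴿ (a ℕ.+ c)
  vandermonde zero b c N _ = begin
    sumTo N (λ j → 0 Cᴿ j * b Cᴿ (c ℕ.+ j))    ≈⟨ sumTo-head N _ (λ k → zeroˡ _) ⟩
    0 Cᴿ 0 * b Cᴿ (c ℕ.+ 0)                    ≈⟨ *-congʳ (+-identityʳ 1#) ⟩
    1# * b Cᴿ (c ℕ.+ 0)                        ≈⟨ *-identityˡ _ ⟩
    b Cᴿ (c ℕ.+ 0)                             ≡⟨ ≡.cong (b Cᴿ_) (ℕ.+-identityʳ c) ⟩
    b Cᴿ c                                     ∎
  vandermonde (suc a) b c (suc N) (ℕ.s≤s a≤N) = begin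
    sumTo (suc N) (λ j → suc a Cᴿ j * b Cᴿ (c ℕ.+ j))
      ≈⟨ sumTo-unfoldˡ N _ ⟩
    t₀ + sumTo N (λ j → suc a Cᴿ suc j * b Cᴿ (c ℕ.+ suc j))
      ≈⟨ +-congˡ (sumTo-cong N (λ j → trans (*-congʳ (sym (nCᴿk+nCᴿ[k+1]≈[n+1]Cᴿ[k+1] a j))) (distribʳ _ _ _))) ⟩
    t₀ + sumTo N (λ j → a Cᴿ j * b Cᴿ (c ℕ.+ suc j) + a Cᴿ suc j * b Cᴿ (c ℕ.+ suc j))
      ≈⟨ +-congˡ (sumTo-distrib-+ N _ _) ⟩
    t₀ + (Σ₁ + Σ₂)
      ≈⟨ solve 3 (λ x y z → x :+ (y :+ z) := (x :+ z) :+ y) refl t₀ Σ₁ Σ₂ ⟩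
    (t₀ + Σ₂) + Σ₁
      ≈⟨ +-cong (trans (sym (sumTo-unfoldˡ N (λ j → a Cᴿ j * b Cᴿ (c ℕ.+ j)))) (vandermonde a b c (suc N) (ℕ.m≤n⇒m≤1+n a≤N)))
                (trans (sumTo-cong N (λ j → *-congˡ (reflexive (≡.cong (b Cᴿ_) (ℕ.+-suc c j))))) (vandermonde a b (suc c) N a≤N)) ⟩
    (a ℕ.+ b) Cᴿ (a ℕ.+ c) + (a ℕ.+ b) Cᴿ (a ℕ.+ suc c)
      ≡⟨ ≡.cong (λ x → (a ℕ.+ b) Cᴿ (a ℕ.+ c) + (a ℕ.+ b) Cᴿ x) (ℕ.+-suc a c) ⟩
    (a ℕ.+ b) Cᴿ (a ℕ.+ c) + (a ℕ.+ b) Cᴿ suc (a ℕ.+ c)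
      ≈⟨ nCᴿk+nCᴿ[k+1]≈[n+1]Cᴿ[k+1] (a ℕ.+ b) (a ℕ.+ c) ⟩
    (suc a ℕ.+ b) Cᴿ (suc a ℕ.+ c)
      ∎
    where
    t₀ Σ₁ Σ₂ : Carrier
    t₀ = suc a Cᴿ 0 * b Cᴿ (c ℕ.+ 0)
    Σ₁ = sumTo N (λ j → a Cᴿ j * b Cᴿ (c ℕ.+ suc j))
    Σ₂ = sumTo N (λ j → a Cᴿ suc j * b Cᴿ (c ℕ.+ suc j))

  ∑ⱼkCj*mCj*jCi≈mCi*[k+m∸i]Cm : ∀ k m i → i ℕ.≤ k ℕ.+ m →
    sumTo (k ℕ.+ m) (λ j → k Cᴿ j * m Cᴿ j * j Cᴿ i) ≈ m Cᴿ i * (k ℕ.+ m ∸ i) Cᴿ m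
  ∑ⱼkCj*mCj*jCi≈mCi*[k+m∸i]Cm k m i i≤n = begin
    sumTo n g                                                        ≡⟨ ≡.cong (λ N → sumTo N g) (ℕ.m+[n∸m]≡n i≤n) ⟨
    sumTo (i ℕ.+ (n ∸ i)) g                                          ≈⟨ sumTo-dropˡ i (n ∸ i) g (λ j j<i → y≈0⇒x*y≈0 _ (k>n⇒nCᴿk≈0 j<i)) ⟩
    sumTo (n ∸ i) (λ l → g (i ℕ.+ l))                                ≈⟨ sumTo-cong (n ∸ i) regroup ⟩
    sumTo (n ∸ i) (λ l → m Cᴿ i * ((m ∸ i) Cᴿ l * k Cᴿ (i ℕ.+ l)))   ≈⟨ *-distribˡ-sumTo (n ∸ i) (m Cᴿ i) _ ⟨
    m Cᴿ i * sumTo (n ∸ i) (λ l → (m ∸ i) Cᴿ l * k Cᴿ (i ℕ.+ l))     ≈⟨ *-congˡ (vandermonde (m ∸ i) k i (n ∸ i) m∸i≤n∸i) ⟩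
    m Cᴿ i * ((m ∸ i) ℕ.+ k) Cᴿ ((m ∸ i) ℕ.+ i)                      ≈⟨ reindex ⟩
    m Cᴿ i * (n ∸ i) Cᴿ m                                            ∎
    where
    n : ℕ
    n = k ℕ.+ m
    m∸i≤n∸i : m ∸ i ℕ.≤ n ∸ i
    m∸i≤n∸i = ℕ.∸-monoˡ-≤ i (ℕ.m≤n+m m k)
    g : ℕ → Carrier
    g j = k Cᴿ j * m Cᴿ j * j Cᴿ i
    regroup : ∀ l → g (i ℕ.+ l) ≈ m Cᴿ i * ((m ∸ i) Cᴿ l * k Cᴿ (i ℕ.+ l))
    regroup l = begin
      k Cᴿ (i ℕ.+ l) * m Cᴿ (i ℕ.+ l) * (i ℕ.+ l) Cᴿ i
        ≈⟨ solve 3 (λ x y z → x :* y :* z := (y :* z) :* x) refl (k Cᴿ (i ℕ.+ l)) (m Cᴿ (i ℕ.+ l)) ((i ℕ.+ l) Cᴿ i) ⟩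
      (m Cᴿ (i ℕ.+ l) * (i ℕ.+ l) Cᴿ i) * k Cᴿ (i ℕ.+ l)
        ≈⟨ *-congʳ (fromℕ-*-≡ (m C (i ℕ.+ l)) ((i ℕ.+ l) C i) (m C i) ((m ∸ i) C l) (nC[i+l]*[i+l]Ci≡nCi*[n∸i]Cl m i l)) ⟩
      (m Cᴿ i * (m ∸ i) Cᴿ l) * k Cᴿ (i ℕ.+ l)
        ≈⟨ *-assoc _ _ _ ⟩
      m Cᴿ i * ((m ∸ i) Cᴿ l * k Cᴿ (i ℕ.+ l))
        ∎
    reindex : m Cᴿ i * ((m ∸ i) ℕ.+ k) Cᴿ ((m ∸ i) ℕ.+ i) ≈ m Cᴿ i * (n ∸ i) Cᴿ m
    reindex with i ℕ.≤? m
    ... | yes i≤m = *-congˡ (reflexive (≡.cong₂ _Cᴿ_ (≡.trans (ℕ.+-comm (m ∸ i) k) (≡.sym (ℕ.+-∸-assoc k i≤m))) (ℕ.m∸n+n≡m i≤m)))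
    ... | no i≰m  = x≈0⇒x*y≈x*z _ _ (k>n⇒nCᴿk≈0 (ℕ.≰⇒> i≰m))

  ∑ⱼkCj*mCj*[k+m+j]Cj≈[k+m]Cm² : ∀ k m →
    sumTo (k ℕ.+ m) (λ j → k Cᴿ j * m Cᴿ j * (k ℕ.+ m ℕ.+ j) Cᴿ j) ≈ (k ℕ.+ m) Cᴿ m * (k ℕ.+ m) Cᴿ m
  ∑ⱼkCj*mCj*[k+m+j]Cj≈[k+m]Cm² k m = begin
    sumTo n (λ j → k Cᴿ j * m Cᴿ j * (n ℕ.+ j) Cᴿ j)                    ≈⟨ sumTo-cong≤ n expand ⟩
    sumTo n (λ j → sumTo n (λ i → n Cᴿ i * (k Cᴿ j * m Cᴿ j * j Cᴿ i)))  ≈⟨ sumTo-comm n n _ ⟩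
    sumTo n (λ i → sumTo n (λ j → n Cᴿ i * (k Cᴿ j * m Cᴿ j * j Cᴿ i)))  ≈⟨ sumTo-cong≤ n collapse ⟩
    sumTo n (λ i → n Cᴿ m * (m Cᴿ i * k Cᴿ (0 ℕ.+ i)))                  ≈⟨ *-distribˡ-sumTo n (n Cᴿ m) _ ⟨
    n Cᴿ m * sumTo n (λ i → m Cᴿ i * k Cᴿ (0 ℕ.+ i))                    ≈⟨ *-congˡ (vandermonde m k 0 n (ℕ.m≤n+m m k)) ⟩
    n Cᴿ m * (m ℕ.+ k) Cᴿ (m ℕ.+ 0)                                     ≡⟨ ≡.cong₂ (λ x y → n Cᴿ m * x Cᴿ y) (ℕ.+-comm m k) (ℕ.+-identityʳ m) ⟩
    n Cᴿ m * n Cᴿ m                                                     ∎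
    where
    n : ℕ
    n = k ℕ.+ m
    expand : ∀ j → j ℕ.≤ n → k Cᴿ j * m Cᴿ j * (n ℕ.+ j) Cᴿ j ≈ sumTo n (λ i → n Cᴿ i * (k Cᴿ j * m Cᴿ j * j Cᴿ i))
    expand j j≤n = begin
      k Cᴿ j * m Cᴿ j * (n ℕ.+ j) Cᴿ j                        ≡⟨ ≡.cong₂ (λ x y → k Cᴿ j * m Cᴿ j * x Cᴿ y) (ℕ.+-comm n j) (≡.sym (ℕ.+-identityʳ j)) ⟩
      k Cᴿ j * m Cᴿ j * (j ℕ.+ n) Cᴿ (j ℕ.+ 0)                ≈⟨ *-congˡ (vandermonde j n 0 n j≤n) ⟨
      k Cᴿ j * m Cᴿ j * sumTo n (λ i → j Cᴿ i * n Cᴿ i)       ≈⟨ *-distribˡ-sumTo n _ _ ⟩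
      sumTo n (λ i → k Cᴿ j * m Cᴿ j * (j Cᴿ i * n Cᴿ i))     ≈⟨ sumTo-cong n (λ i → solve 4 (λ x y z w → x :* y :* (z :* w) := w :* (x :* y :* z))
                                                                    refl (k Cᴿ j) (m Cᴿ j) (j Cᴿ i) (n Cᴿ i)) ⟩
      sumTo n (λ i → n Cᴿ i * (k Cᴿ j * m Cᴿ j * j Cᴿ i))     ∎
    collapse : ∀ i → i ℕ.≤ n → sumTo n (λ j → n Cᴿ i * (k Cᴿ j * m Cᴿ j * j Cᴿ i)) ≈ n Cᴿ m * (m Cᴿ i * k Cᴿ (0 ℕ.+ i))
    collapse i i≤n = begin
      sumTo n (λ j → n Cᴿ i * (k Cᴿ j * m Cᴿ j * j Cᴿ i))   ≈⟨ *-distribˡ-sumTo n (n Cᴿ i) _ ⟨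
      n Cᴿ i * sumTo n (λ j → k Cᴿ j * m Cᴿ j * j Cᴿ i)     ≈⟨ *-congˡ (∑ⱼkCj*mCj*jCi≈mCi*[k+m∸i]Cm k m i i≤n) ⟩
      n Cᴿ i * (m Cᴿ i * (n ∸ i) Cᴿ m)                      ≈⟨ x*[y*z]≈y*[x*z] (n Cᴿ i) (m Cᴿ i) ((n ∸ i) Cᴿ m) ⟩
      m Cᴿ i * (n Cᴿ i * (n ∸ i) Cᴿ m)                      ≈⟨ *-congˡ (fromℕ-*-≡ (n C i) ((n ∸ i) C m) (n C m) ((n ∸ m) C i)
                                                                           (nCi*[n∸i]Cm≡nCm*[n∸m]Ci n i m)) ⟩
      m Cᴿ i * (n Cᴿ m * (n ∸ m) Cᴿ i)                      ≡⟨ ≡.cong (λ x → m Cᴿ i * (n Cᴿ m * x Cᴿ i)) (ℕ.m+n∸n≡m k m) ⟩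
      m Cᴿ i * (n Cᴿ m * k Cᴿ i)                            ≈⟨ x*[y*z]≈y*[x*z] (m Cᴿ i) (n Cᴿ m) (k Cᴿ i) ⟩
      n Cᴿ m * (m Cᴿ i * k Cᴿ i)                            ∎

  -- v^s acts on H as the s-th power of the sum of the two commuting unit shifts, expanded binomially.
  module _ (v : Carrier) (H : ℕ → ℕ → Carrier)
           (v*H≈shifts : ∀ i j → v * H i j ≈ H (suc i) j + H i (suc j)) where

    private
      H-cong : ∀ {i i′ j j′} → i ≡ i′ → j ≡ j′ → H i j ≈ H i′ j′
      H-cong i≡i′ j≡j′ = reflexive (≡.cong₂ H i≡i′ j≡j′)

    pow*H≈∑binomial*H : ∀ s N → s ℕ.≤ N → ∀ i j →
      sumTo N (λ l → s Cᴿ l * H (i ℕ.+ (s ∸ l)) (j ℕ.+ l)) ≈ pow v s * H i j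
    pow*H≈∑binomial*H zero N _ i j = begin
      sumTo N (λ l → 0 Cᴿ l * H (i ℕ.+ (0 ∸ l)) (j ℕ.+ l))  ≈⟨ sumTo-head N _ (λ _ → zeroˡ _) ⟩
      0 Cᴿ 0 * H (i ℕ.+ 0) (j ℕ.+ 0)                        ≈⟨ *-cong (+-identityʳ 1#) (H-cong (ℕ.+-identityʳ i) (ℕ.+-identityʳ j)) ⟩
      1# * H i j                                            ∎
    pow*H≈∑binomial*H (suc s) (suc N) (ℕ.s≤s s≤N) i j = sym (begin
      (v * pow v s) * H i j                                ≈⟨ solve 3 (λ v p h → (v :* p) :* h := p :* (v :* h)) refl v (pow v s) (H i j) ⟩
      pow v s * (v * H i j)                                ≈⟨ trans (*-congˡ (v*H≈shifts i j)) (distribˡ _ _ _) ⟩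
      pow v s * H (suc i) j + pow v s * H i (suc j)        ≈⟨ +-cong (sym (ih (suc i) j)) (sym (ih i (suc j))) ⟩
      Σ₁ + Σ₂                                              ≈⟨ +-cong Σ₁≈t₀+Σ₊ Σ₂≈Σ₀ ⟩
      (t₀ + Σ₊) + Σ₀                                       ≈⟨ solve 3 (λ t x y → (t :+ x) :+ y := t :+ (y :+ x)) refl t₀ Σ₊ Σ₀ ⟩
      t₀ + (Σ₀ + Σ₊)                                       ≈⟨ +-congˡ (sym (sumTo-distrib-+ N _ _)) ⟩
      t₀ + sumTo N (λ l → s Cᴿ l * G l + s Cᴿ suc l * G l)  ≈⟨ +-congˡ (sumTo-cong N pascal) ⟩
      t₀ + sumTo N (λ l → suc s Cᴿ suc l * G l)            ≈⟨ sumTo-unfoldˡ N _ ⟨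
      sumTo (suc N) (λ l → suc s Cᴿ l * H (i ℕ.+ (suc s ∸ l)) (j ℕ.+ l)) ∎)
      where
      ih : ∀ i j → sumTo (suc N) (λ l → s Cᴿ l * H (i ℕ.+ (s ∸ l)) (j ℕ.+ l)) ≈ pow v s * H i j
      ih = pow*H≈∑binomial*H s (suc N) (ℕ.m≤n⇒m≤1+n s≤N)
      G : ℕ → Carrier
      G l = H (i ℕ.+ (s ∸ l)) (j ℕ.+ suc l)
      t₀ Σ₀ Σ₊ Σ₁ Σ₂ : Carrier
      t₀ = suc s Cᴿ 0 * H (i ℕ.+ suc s) (j ℕ.+ 0)
      Σ₀ = sumTo N (λ l → s Cᴿ l * G l)
      Σ₊ = sumTo N (λ l → s Cᴿ suc l * G l)
      Σ₁ = sumTo (suc N) (λ l → s Cᴿ l * H (suc i ℕ.+ (s ∸ l)) (j ℕ.+ l))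
      Σ₂ = sumTo (suc N) (λ l → s Cᴿ l * H (i ℕ.+ (s ∸ l)) (suc j ℕ.+ l))
      Σ₁≈t₀+Σ₊ : Σ₁ ≈ t₀ + Σ₊
      Σ₁≈t₀+Σ₊ = trans (sumTo-unfoldˡ N _) (+-cong (*-congˡ (H-cong (≡.sym (ℕ.+-suc i s)) ≡.refl)) (sumTo-cong N term))
        where
        term : ∀ l → s Cᴿ suc l * H (suc i ℕ.+ (s ∸ suc l)) (j ℕ.+ suc l) ≈ s Cᴿ suc l * G l
        term l with suc l ℕ.≤? s
        ... | yes l<s = *-congˡ (H-cong (≡.trans (≡.sym (ℕ.+-suc i (s ∸ suc l))) (≡.cong (i ℕ.+_) (≡.sym (ℕ.+-∸-assoc 1 l<s)))) ≡.refl)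
        ... | no  l≮s = x≈0⇒x*y≈x*z _ _ (k>n⇒nCᴿk≈0 (ℕ.≰⇒> l≮s))
      Σ₂≈Σ₀ : Σ₂ ≈ Σ₀
      Σ₂≈Σ₀ = trans (+-cong (sumTo-cong N (λ l → *-congˡ (H-cong ≡.refl (≡.sym (ℕ.+-suc j l)))))
                            (x≈0⇒x*y≈0 _ (k>n⇒nCᴿk≈0 (ℕ.s≤s s≤N))))
                    (+-identityʳ _)
      pascal : ∀ l → s Cᴿ l * G l + s Cᴿ suc l * G l ≈ suc s Cᴿ suc l * G l
      pascal l = trans (sym (distribʳ (G l) _ _)) (*-congʳ (nCᴿk+nCᴿ[k+1]≈[n+1]Cᴿ[k+1] s l))

  pow-+ : ∀ x m n → pow x (m ℕ.+ n) ≈ pow x m * pow x n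
  pow-+ x zero    n = sym (*-identityˡ _)
  pow-+ x (suc m) n = trans (*-congˡ (pow-+ x m n)) (sym (*-assoc _ _ _))

  pow-* : ∀ x m n → pow x (m ℕ.* n) ≈ pow (pow x n) m
  pow-* x zero    n = refl
  pow-* x (suc m) n = trans (pow-+ x n (m ℕ.* n)) (*-congˡ (pow-* x m n))

  module _ (p q qinv : Carrier) (q*qinv≈1 : q * qinv ≈ 1#) where

    W[_,_] : Carrier → Carrier → ℤ → Carrier
    W[ a , b ] = W a b p q qinv

    private
      W-cong : ∀ a b {i j} → i ≡ j → W[ a , b ] i ≈ W[ a , b ] j
      W-cong a b i≡j = reflexive (≡.cong W[ a , b ] i≡j)

      p*x-q*[qinv*[p*x-y]]≈y : ∀ x y → p * x - q * (qinv * (p * x - y)) ≈ y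
      p*x-q*[qinv*[p*x-y]]≈y x y = begin
        p * x - q * (qinv * (p * x - y))  ≈⟨ +-congˡ (-‿cong (*-assoc q qinv _)) ⟨
        p * x - (q * qinv) * (p * x - y)  ≈⟨ +-congˡ (-‿cong (trans (*-congʳ q*qinv≈1) (*-identityˡ _))) ⟩
        p * x - (p * x - y)               ≈⟨ solve 2 (λ x y → x :- (x :- y) := y) refl (p * x) y ⟩
        y                                 ∎

    W-recurrence : ∀ a b j → W[ a , b ] (j ℤ.+ + 2) ≈ p * W[ a , b ] (j ℤ.+ + 1) - q * W[ a , b ] j
    W-recurrence a b (+ n) = trans (W-cong a b (≡.cong +_ (ℕ.+-comm n 2)))
                                   (sym (+-congʳ (*-congˡ (W-cong a b (≡.cong +_ (ℕ.+-comm n 1))))))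
    W-recurrence a b -[1+ 0 ]           = sym (p*x-q*[qinv*[p*x-y]]≈y a b)
    W-recurrence a b -[1+ 1 ]           = sym (p*x-q*[qinv*[p*x-y]]≈y (W[ a , b ] -[1+ 0 ]) a)
    W-recurrence a b -[1+ suc (suc k) ] = sym (p*x-q*[qinv*[p*x-y]]≈y (W[ a , b ] -[1+ suc k ]) (W[ a , b ] -[1+ k ]))

    W[m+r]+qʳW[m-r]≈VᵣWₘ : ∀ a b r m →
      W[ a , b ] (m ℤ.+ + r) + pow q r * W[ a , b ] (m ℤ.- + r) ≈ V p q qinv (+ r) * W[ a , b ] m
    W[m+r]+qʳW[m-r]≈VᵣWₘ a b zero m = begin
      W[ a , b ] (m ℤ.+ + 0) + 1# * W[ a , b ] (m ℤ.- + 0)  ≈⟨ +-cong (W-cong a b (m+0≡m m)) (trans (*-identityˡ _) (W-cong a b (m-0≡m m))) ⟩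
      W[ a , b ] m + W[ a , b ] m                          ≈⟨ +-cong (*-identityˡ _) (*-identityˡ _) ⟨
      1# * W[ a , b ] m + 1# * W[ a , b ] m                ≈⟨ distribʳ _ _ _ ⟨
      (1# + 1#) * W[ a , b ] m                             ∎
      where
      m+0≡m : ∀ m → m ℤ.+ + 0 ≡ m
      m+0≡m = solve-∀
      m-0≡m : ∀ m → m ℤ.- + 0 ≡ m
      m-0≡m = solve-∀
    W[m+r]+qʳW[m-r]≈VᵣWₘ a b 1 m = begin
      W[ a , b ] (m ℤ.+ + 1) + (q * 1#) * W[ a , b ] (m ℤ.- + 1)      ≈⟨ +-cong (W-cong a b (m+1≡[m-1]+2 m)) (*-congʳ (*-identityʳ q)) ⟩
      W[ a , b ] ((m ℤ.- + 1) ℤ.+ + 2) + q * W[ a , b ] (m ℤ.- + 1)  ≈⟨ +-congʳ (W-recurrence a b (m ℤ.- + 1)) ⟩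
      (p * W[ a , b ] ((m ℤ.- + 1) ℤ.+ + 1) - q * W[ a , b ] (m ℤ.- + 1)) + q * W[ a , b ] (m ℤ.- + 1)
        ≈⟨ +-congʳ (+-congʳ (*-congˡ (W-cong a b ([m-1]+1≡m m)))) ⟩
      (p * W[ a , b ] m - q * W[ a , b ] (m ℤ.- + 1)) + q * W[ a , b ] (m ℤ.- + 1)
        ≈⟨ solve 2 (λ x y → (x :- y) :+ y := x) refl (p * W[ a , b ] m) (q * W[ a , b ] (m ℤ.- + 1)) ⟩
      p * W[ a , b ] m                                                 ∎
      where
      m+1≡[m-1]+2 : ∀ m → m ℤ.+ + 1 ≡ (m ℤ.- + 1) ℤ.+ + 2
      m+1≡[m-1]+2 = solve-∀
      [m-1]+1≡m : ∀ m → (m ℤ.- + 1) ℤ.+ + 1 ≡ m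
      [m-1]+1≡m = solve-∀
    W[m+r]+qʳW[m-r]≈VᵣWₘ a b (suc (suc r)) m = sym (begin
      V p q qinv (+ suc (suc r)) * W[ a , b ] m  ≈⟨ *-congʳ V-recurrence ⟩
      (p * V₁ - q * V₀) * W[ a , b ] m          ≈⟨ solve 5 (λ p q x y w → (p :* x :- q :* y) :* w := p :* (x :* w) :- q :* (y :* w))
                                                           refl p q V₁ V₀ (W[ a , b ] m) ⟩
      p * (V₁ * W[ a , b ] m) - q * (V₀ * W[ a , b ] m)
        ≈⟨ +-cong (*-congˡ (sym (W[m+r]+qʳW[m-r]≈VᵣWₘ a b (suc r) m))) (-‿cong (*-congˡ (sym (W[m+r]+qʳW[m-r]≈VᵣWₘ a b r m)))) ⟩
      p * (w₁ + (q * qʳ) * w₋₁) - q * (w₀ + qʳ * w₋₀)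
        ≈⟨ +-congˡ (-‿cong (*-congˡ (+-congˡ (*-congˡ w₋₀≈)))) ⟩
      p * (w₁ + (q * qʳ) * w₋₁) - q * (w₀ + qʳ * (p * w₋₁ - q * w₋₂))
        ≈⟨ solve 7 (λ p q A B C D X → p :* (A :+ (q :* X) :* B) :- q :* (C :+ X :* (p :* B :- q :* D))
                                      := (p :* A :- q :* C) :+ (q :* (q :* X)) :* D) refl p q w₁ w₋₁ w₀ w₋₂ qʳ ⟩
      (p * w₁ - q * w₀) + (q * (q * qʳ)) * w₋₂  ≈⟨ +-congʳ w₂≈ ⟨
      W[ a , b ] (m ℤ.+ + suc (suc r)) + (q * (q * qʳ)) * w₋₂ ∎)
      where
      qʳ V₀ V₁ w₀ w₁ w₋₀ w₋₁ w₋₂ : Carrier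
      qʳ = pow q r
      V₀ = V p q qinv (+ r)
      V₁ = V p q qinv (+ suc r)
      w₀  = W[ a , b ] (m ℤ.+ + r)
      w₁  = W[ a , b ] (m ℤ.+ + suc r)
      w₋₀ = W[ a , b ] (m ℤ.- + r)
      w₋₁ = W[ a , b ] (m ℤ.- + suc r)
      w₋₂ = W[ a , b ] (m ℤ.- + suc (suc r))
      [m+r]+2≡m+[2+r] : ∀ m r → (m ℤ.+ r) ℤ.+ + 2 ≡ m ℤ.+ (+ 2 ℤ.+ r)
      [m+r]+2≡m+[2+r] = solve-∀
      [m+r]+1≡m+[1+r] : ∀ m r → (m ℤ.+ r) ℤ.+ + 1 ≡ m ℤ.+ (+ 1 ℤ.+ r)
      [m+r]+1≡m+[1+r] = solve-∀
      [m-[2+r]]+2≡m-r : ∀ m r → (m ℤ.- (+ 2 ℤ.+ r)) ℤ.+ + 2 ≡ m ℤ.- r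
      [m-[2+r]]+2≡m-r = solve-∀
      [m-[2+r]]+1≡m-[1+r] : ∀ m r → (m ℤ.- (+ 2 ℤ.+ r)) ℤ.+ + 1 ≡ m ℤ.- (+ 1 ℤ.+ r)
      [m-[2+r]]+1≡m-[1+r] = solve-∀
      V-recurrence : V p q qinv (+ suc (suc r)) ≈ p * V₁ - q * V₀
      V-recurrence = trans (W-cong _ _ (≡.cong +_ (ℕ.+-comm 2 r)))
                           (trans (W-recurrence (1# + 1#) p (+ r)) (+-congʳ (*-congˡ (W-cong _ _ (≡.cong +_ (ℕ.+-comm r 1))))))
      w₂≈ : W[ a , b ] (m ℤ.+ + suc (suc r)) ≈ p * w₁ - q * w₀
      w₂≈ = trans (W-cong a b (≡.sym ([m+r]+2≡m+[2+r] m (+ r))))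
                  (trans (W-recurrence a b (m ℤ.+ + r)) (+-congʳ (*-congˡ (W-cong a b ([m+r]+1≡m+[1+r] m (+ r))))))
      w₋₀≈ : w₋₀ ≈ p * w₋₁ - q * w₋₂
      w₋₀≈ = trans (W-cong a b (≡.sym ([m-[2+r]]+2≡m-r m (+ r))))
                   (trans (W-recurrence a b (m ℤ.- + suc (suc r))) (+-congʳ (*-congˡ (W-cong a b ([m-[2+r]]+1≡m-[1+r] m (+ r))))))

    private
      qinvˢ*qˢ≈1 : ∀ s → pow qinv s * pow q s ≈ 1#
      qinvˢ*qˢ≈1 zero    = *-identityˡ 1#
      qinvˢ*qˢ≈1 (suc s) = begin
        (qinv * pow qinv s) * (q * pow q s)  ≈⟨ solve 4 (λ a b c d → (a :* b) :* (c :* d) := (c :* a) :* (b :* d)) refl qinv (pow qinv s) q (pow q s) ⟩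
        (q * qinv) * (pow qinv s * pow q s)  ≈⟨ *-cong q*qinv≈1 (qinvˢ*qˢ≈1 s) ⟩
        1# * 1#                              ≈⟨ *-identityˡ 1# ⟩
        1#                                   ∎

    -- Taking a = 2, b = p and m = 0 in W[m+r]+qʳW[m-r]≈VᵣWₘ gives V_s + q^s V_{-s} = 2 V_s.
    V[-s]≈qinvˢVₛ : ∀ n → V p q qinv -[1+ n ] ≈ pow qinv (suc n) * V p q qinv (+ suc n)
    V[-s]≈qinvˢVₛ n = begin
      V₋ₛ                         ≈⟨ *-identityˡ V₋ₛ ⟨
      1# * V₋ₛ                    ≈⟨ *-congʳ (qinvˢ*qˢ≈1 s) ⟨
      (pow qinv s * pow q s) * V₋ₛ ≈⟨ *-assoc _ _ _ ⟩
      pow qinv s * (pow q s * V₋ₛ) ≈⟨ *-congˡ qˢV₋ₛ≈Vₛ ⟩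
      pow qinv s * Vₛ             ∎
      where
      s : ℕ
      s = suc n
      Vₛ V₋ₛ : Carrier
      Vₛ = V p q qinv (+ s)
      V₋ₛ = V p q qinv -[1+ n ]
      qˢV₋ₛ≈Vₛ : pow q s * V₋ₛ ≈ Vₛ
      qˢV₋ₛ≈Vₛ = begin
        pow q s * V₋ₛ               ≈⟨ solve 2 (λ x y → y := (x :+ y) :- x) refl Vₛ (pow q s * V₋ₛ) ⟩
        (Vₛ + pow q s * V₋ₛ) - Vₛ   ≈⟨ +-congʳ (W[m+r]+qʳW[m-r]≈VᵣWₘ (1# + 1#) p s (+ 0)) ⟩
        Vₛ * (1# + 1#) - Vₛ         ≈⟨ +-congʳ (trans (distribˡ _ _ _) (+-cong (*-identityʳ _) (*-identityʳ _))) ⟩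
        (Vₛ + Vₛ) - Vₛ              ≈⟨ solve 1 (λ x → (x :+ x) :- x := x) refl Vₛ ⟩
        Vₛ                          ∎

    W[m+r]+qʳW[m-r]≈VᵣWₘ-ℤ : ∀ a b (r m : ℤ) →
      W[ a , b ] (m ℤ.+ r) + zpow q qinv r * W[ a , b ] (m ℤ.- r) ≈ V p q qinv r * W[ a , b ] m
    W[m+r]+qʳW[m-r]≈VᵣWₘ-ℤ a b (+ n)    m = W[m+r]+qʳW[m-r]≈VᵣWₘ a b n m
    W[m+r]+qʳW[m-r]≈VᵣWₘ-ℤ a b -[1+ n ] m = sym (begin
      V p q qinv -[1+ n ] * W[ a , b ] m          ≈⟨ *-congʳ (V[-s]≈qinvˢVₛ n) ⟩
      (qinvˢ * V p q qinv (+ s)) * W[ a , b ] m   ≈⟨ *-assoc _ _ _ ⟩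
      qinvˢ * (V p q qinv (+ s) * W[ a , b ] m)   ≈⟨ *-congˡ (W[m+r]+qʳW[m-r]≈VᵣWₘ a b s m) ⟨
      qinvˢ * (w₊ + pow q s * w₋)                ≈⟨ solve 4 (λ i q x y → i :* (x :+ q :* y) := (i :* q) :* y :+ i :* x) refl qinvˢ (pow q s) w₊ w₋ ⟩
      (qinvˢ * pow q s) * w₋ + qinvˢ * w₊        ≈⟨ +-congʳ (trans (*-congʳ (qinvˢ*qˢ≈1 s)) (*-identityˡ w₋)) ⟩
      w₋ + qinvˢ * w₊                           ∎)
      where
      s : ℕ
      s = suc n
      qinvˢ w₊ w₋ : Carrier
      qinvˢ = pow qinv s
      w₊ = W[ a , b ] (m ℤ.+ + s)
      w₋ = W[ a , b ] (m ℤ.- + s)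

    zpow-*-+ : ∀ r j → zpow q qinv (r ℤ.* + j) ≈ pow (zpow q qinv r) j
    zpow-*-+ (+ s) j = begin
      zpow q qinv (+ s ℤ.* + j)   ≡⟨ ≡.cong (zpow q qinv) (ℤ.pos-* s j) ⟨
      pow q (s ℕ.* j)             ≡⟨ ≡.cong (pow q) (ℕ.*-comm s j) ⟩
      pow q (j ℕ.* s)             ≈⟨ pow-* q j s ⟩
      pow (pow q s) j             ∎
    zpow-*-+ -[1+ s ] j = begin
      zpow q qinv (-[1+ s ] ℤ.* + j)        ≡⟨ ≡.cong (zpow q qinv) (ℤ.neg-distribˡ-* (+ suc s) (+ j)) ⟨
      zpow q qinv (ℤ.- (+ suc s ℤ.* + j))   ≡⟨ ≡.cong (λ z → zpow q qinv (ℤ.- z)) (ℤ.pos-* (suc s) j) ⟨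
      zpow q qinv (ℤ.- + (suc s ℕ.* j))     ≡⟨ zpow-neg (suc s ℕ.* j) ⟩
      pow qinv (suc s ℕ.* j)                ≡⟨ ≡.cong (pow qinv) (ℕ.*-comm (suc s) j) ⟩
      pow qinv (j ℕ.* suc s)                ≈⟨ pow-* qinv j (suc s) ⟩
      pow (pow qinv (suc s)) j              ∎
      where
      zpow-neg : ∀ k → zpow q qinv (ℤ.- + k) ≡ pow qinv k
      zpow-neg zero    = ≡.refl
      zpow-neg (suc k) = ≡.refl

    module _ (a b : Carrier) (r t : ℤ) where

      H : ℕ → ℕ → Carrier
      H i j = pow (zpow q qinv r) j * W[ a , b ] (r ℤ.* (+ i ℤ.- + j) ℤ.+ t)

      Vᵣ*H≈shifts : ∀ i j → V p q qinv r * H i j ≈ H (suc i) j + H i (suc j)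
      Vᵣ*H≈shifts i j = begin
        Vᵣ * (Qʲ * W[ a , b ] m)                                   ≈⟨ x*[y*z]≈y*[x*z] Vᵣ Qʲ (W[ a , b ] m) ⟩
        Qʲ * (Vᵣ * W[ a , b ] m)                                   ≈⟨ *-congˡ (W[m+r]+qʳW[m-r]≈VᵣWₘ-ℤ a b r m) ⟨
        Qʲ * (W[ a , b ] (m ℤ.+ r) + Q * W[ a , b ] (m ℤ.- r))     ≈⟨ solve 4 (λ x y z w → x :* (y :+ z :* w) := x :* y :+ (z :* x) :* w) refl
                                                                         Qʲ (W[ a , b ] (m ℤ.+ r)) Q (W[ a , b ] (m ℤ.- r)) ⟩
        Qʲ * W[ a , b ] (m ℤ.+ r) + (Q * Qʲ) * W[ a , b ] (m ℤ.- r) ≈⟨ +-cong (*-congˡ (W-cong a b (m+r≡ r (+ i) (+ j) t)))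
                                                                             (*-congˡ (W-cong a b (m-r≡ r (+ i) (+ j) t))) ⟩
        H (suc i) j + H i (suc j)                                  ∎
        where
        Vᵣ Q Qʲ : Carrier
        Vᵣ = V p q qinv r
        Q  = zpow q qinv r
        Qʲ = pow Q j
        m : ℤ
        m  = r ℤ.* (+ i ℤ.- + j) ℤ.+ t
        m+r≡ : ∀ r i j t → (r ℤ.* (i ℤ.- j) ℤ.+ t) ℤ.+ r ≡ r ℤ.* ((+ 1 ℤ.+ i) ℤ.- j) ℤ.+ t
        m+r≡ = solve-∀
        m-r≡ : ∀ r i j t → (r ℤ.* (i ℤ.- j) ℤ.+ t) ℤ.- r ≡ r ℤ.* (i ℤ.- (+ 1 ℤ.+ j)) ℤ.+ t
        m-r≡ = solve-∀

      H-diagonal : ∀ j → H j j ≈ pow (zpow q qinv r) j * W[ a , b ] t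
      H-diagonal j = *-congˡ (W-cong a b (r*[j-j]+t≡t r (+ j) t))
        where
        r*[j-j]+t≡t : ∀ r j t → r ℤ.* (j ℤ.- j) ℤ.+ t ≡ t
        r*[j-j]+t≡t = solve-∀

      module _ (n : ℕ) where

        cubeTerm rhsTerm : ℕ → Carrier
        cubeTerm k = pow (n Cᴿ k) 3 * zpow q qinv (r ℤ.* + k) * W[ a , b ] (r ℤ.* (+ n ℤ.- + (2 ℕ.* k)) ℤ.+ t)
        rhsTerm  j = (n ℕ.+ j) Cᴿ (2 ℕ.* j) * (2 ℕ.* j) Cᴿ j * (n ∸ j) Cᴿ j * zpow q qinv (r ℤ.* + j)
                     * pow (V p q qinv r) (n ∸ 2 ℕ.* j)

        doubleTerm : ℕ → ℕ → Carrier
        doubleTerm j k = (n ℕ.+ j) Cᴿ j * (n Cᴿ k * k Cᴿ j * (n ∸ k) Cᴿ j * H (n ∸ k) k)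

        nCk²≈∑ⱼ : ∀ k → k ℕ.≤ n → n Cᴿ k * n Cᴿ k ≈ sumTo n (λ j → k Cᴿ j * (n ∸ k) Cᴿ j * (n ℕ.+ j) Cᴿ j)
        nCk²≈∑ⱼ k k≤n = sym (trans square (*-cong nC[n∸k]≈nCk nC[n∸k]≈nCk))
          where
          square : sumTo n (λ j → k Cᴿ j * (n ∸ k) Cᴿ j * (n ℕ.+ j) Cᴿ j) ≈ n Cᴿ (n ∸ k) * n Cᴿ (n ∸ k)
          square = ≡.subst (λ N → sumTo N (λ j → k Cᴿ j * (n ∸ k) Cᴿ j * (N ℕ.+ j) Cᴿ j) ≈ N Cᴿ (n ∸ k) * N Cᴿ (n ∸ k))
                           (ℕ.m+[n∸m]≡n k≤n) (∑ⱼkCj*mCj*[k+m+j]Cj≈[k+m]Cm² k (n ∸ k))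
          nC[n∸k]≈nCk : n Cᴿ (n ∸ k) ≈ n Cᴿ k
          nC[n∸k]≈nCk = reflexive (≡.cong fromℕ (≡.sym (nCk≡nC[n∸k] k≤n)))

        cubeTerm≈∑ⱼdoubleTerm : ∀ k → k ℕ.≤ n → cubeTerm k ≈ sumTo n (λ j → doubleTerm j k)
        cubeTerm≈∑ⱼdoubleTerm k k≤n = begin
          pow nCk 3 * zpow q qinv (r ℤ.* + k) * W[ a , b ] (r ℤ.* (+ n ℤ.- + (2 ℕ.* k)) ℤ.+ t)
            ≈⟨ trans (*-assoc _ _ _) (*-cong (*-congˡ (*-congˡ (*-identityʳ nCk))) (*-cong (zpow-*-+ r k) (W-cong a b index))) ⟩
          (nCk * (nCk * nCk)) * h
            ≈⟨ solve 2 (λ c h → (c :* (c :* c)) :* h := (c :* h) :* (c :* c)) refl nCk h ⟩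
          (nCk * h) * (nCk * nCk)
            ≈⟨ *-congˡ (nCk²≈∑ⱼ k k≤n) ⟩
          (nCk * h) * sumTo n (λ j → k Cᴿ j * (n ∸ k) Cᴿ j * (n ℕ.+ j) Cᴿ j)
            ≈⟨ *-distribˡ-sumTo n _ _ ⟩
          sumTo n (λ j → (nCk * h) * (k Cᴿ j * (n ∸ k) Cᴿ j * (n ℕ.+ j) Cᴿ j))
            ≈⟨ sumTo-cong n (λ j → solve 5 (λ c h x y z → (c :* h) :* (x :* y :* z) := z :* (c :* x :* y :* h)) refl
                                          nCk h (k Cᴿ j) ((n ∸ k) Cᴿ j) ((n ℕ.+ j) Cᴿ j)) ⟩
          sumTo n (λ j → doubleTerm j k)
            ∎
          where
          nCk h : Carrier
          nCk = n Cᴿ k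
          h = H (n ∸ k) k
          index : r ℤ.* (+ n ℤ.- + (2 ℕ.* k)) ℤ.+ t ≡ r ℤ.* (+ (n ∸ k) ℤ.- + k) ℤ.+ t
          index = ≡.cong (λ z → r ℤ.* z ℤ.+ t) (≡.trans (≡.cong (λ z → + n ℤ.- z) +[2k]≡+k++k)
                    (≡.trans (n-[k+k]≡[n-k]-k (+ n) (+ k)) (≡.cong (λ z → z ℤ.- + k) (≡.trans (ℤ.m-n≡m⊖n n k) (ℤ.⊖-≥ k≤n)))))
            where
            +[2k]≡+k++k : + (2 ℕ.* k) ≡ + k ℤ.+ + k
            +[2k]≡+k++k = ≡.trans (ℤ.pos-+ k (k ℕ.+ 0)) (≡.cong (λ z → + k ℤ.+ + z) (ℕ.+-identityʳ k))
            n-[k+k]≡[n-k]-k : ∀ n k → n ℤ.- (k ℤ.+ k) ≡ (n ℤ.- k) ℤ.- k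
            n-[k+k]≡[n-k]-k = solve-∀

        ∑ₖnCk*kCj*[n∸k]Cj*H≈nC2j*2jCj*∑ₗ : ∀ j → j ℕ.≤ n →
          sumTo n (λ k → n Cᴿ k * k Cᴿ j * (n ∸ k) Cᴿ j * H (n ∸ k) k)
          ≈ n Cᴿ (2 ℕ.* j) * (2 ℕ.* j) Cᴿ j * sumTo (n ∸ j) (λ l → (n ∸ 2 ℕ.* j) Cᴿ l * H (n ∸ (j ℕ.+ l)) (j ℕ.+ l))
        ∑ₖnCk*kCj*[n∸k]Cj*H≈nC2j*2jCj*∑ₗ j j≤n = begin
          sumTo n E                               ≡⟨ ≡.cong (λ N → sumTo N E) (ℕ.m+[n∸m]≡n j≤n) ⟨
          sumTo (j ℕ.+ (n ∸ j)) E                 ≈⟨ sumTo-dropˡ j (n ∸ j) E E≈0 ⟩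
          sumTo (n ∸ j) (λ l → E (j ℕ.+ l))       ≈⟨ sumTo-cong (n ∸ j) regroup ⟩
          sumTo (n ∸ j) (λ l → K * F l)           ≈⟨ *-distribˡ-sumTo (n ∸ j) K F ⟨
          K * sumTo (n ∸ j) F                     ∎
          where
          E F : ℕ → Carrier
          E k = n Cᴿ k * k Cᴿ j * (n ∸ k) Cᴿ j * H (n ∸ k) k
          F l = (n ∸ 2 ℕ.* j) Cᴿ l * H (n ∸ (j ℕ.+ l)) (j ℕ.+ l)
          K : Carrier
          K = n Cᴿ (2 ℕ.* j) * (2 ℕ.* j) Cᴿ j
          E≈0 : ∀ k → k ℕ.< j → E k ≈ 0#
          E≈0 k k<j = x≈0⇒x*y≈0 _ (x≈0⇒x*y≈0 _ (y≈0⇒x*y≈0 _ (k>n⇒nCᴿk≈0 k<j)))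
          regroup : ∀ l → E (j ℕ.+ l) ≈ K * F l
          regroup l = trans (*-congʳ (fromℕ-*-*-≡ (n C (j ℕ.+ l)) ((j ℕ.+ l) C j) ((n ∸ (j ℕ.+ l)) C j)
                                                  (n C (2 ℕ.* j)) ((2 ℕ.* j) C j) ((n ∸ 2 ℕ.* j) C l)
                                                  (nC[j+l]*[j+l]Cj*[n∸[j+l]]Cj≡nC[2j]*[2j]Cj*[n∸2j]Cl n j l)))
                            (*-assoc K _ _)

        ∑ₗ[n∸2j]Cl*H≈Vᵣ^[n∸2j]*Qʲ*Wₜ : ∀ j → 2 ℕ.* j ℕ.≤ n →
          sumTo (n ∸ j) (λ l → (n ∸ 2 ℕ.* j) Cᴿ l * H (n ∸ (j ℕ.+ l)) (j ℕ.+ l))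
          ≈ pow (V p q qinv r) (n ∸ 2 ℕ.* j) * (pow (zpow q qinv r) j * W[ a , b ] t)
        ∑ₗ[n∸2j]Cl*H≈Vᵣ^[n∸2j]*Qʲ*Wₜ j 2j≤n = begin
          sumTo (n ∸ j) (λ l → s Cᴿ l * H (n ∸ (j ℕ.+ l)) (j ℕ.+ l))    ≈⟨ sumTo-cong (n ∸ j) reindex ⟩
          sumTo (n ∸ j) (λ l → s Cᴿ l * H (j ℕ.+ (s ∸ l)) (j ℕ.+ l))    ≈⟨ pow*H≈∑binomial*H (V p q qinv r) H Vᵣ*H≈shifts s (n ∸ j) s≤n∸j j j ⟩
          pow (V p q qinv r) s * H j j                                   ≈⟨ *-congˡ (H-diagonal j) ⟩
          pow (V p q qinv r) s * (pow (zpow q qinv r) j * W[ a , b ] t)  ∎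
          where
          s : ℕ
          s = n ∸ 2 ℕ.* j
          s≤n∸j : s ℕ.≤ n ∸ j
          s≤n∸j = ℕ.∸-monoʳ-≤ n (ℕ.m≤m+n j (j ℕ.+ 0))
          reindex : ∀ l → s Cᴿ l * H (n ∸ (j ℕ.+ l)) (j ℕ.+ l) ≈ s Cᴿ l * H (j ℕ.+ (s ∸ l)) (j ℕ.+ l)
          reindex l with l ℕ.≤? s
          ... | yes l≤s = *-congˡ (reflexive (≡.cong (λ i → H i (j ℕ.+ l)) (n∸[j+l]≡j+[n∸2j∸l] 2j≤n l≤s)))
          ... | no  l≰s = x≈0⇒x*y≈x*z _ _ (k>n⇒nCᴿk≈0 (ℕ.≰⇒> l≰s))

        ∑ₖdoubleTerm≈Wₜ*rhsTerm : ∀ j → j ℕ.≤ n → sumTo n (λ k → doubleTerm j k) ≈ W[ a , b ] t * rhsTerm j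
        ∑ₖdoubleTerm≈Wₜ*rhsTerm j j≤n with 2 ℕ.* j ℕ.≤? n
        ... | yes 2j≤n = begin
          sumTo n (λ k → doubleTerm j k)           ≈⟨ *-distribˡ-sumTo n A _ ⟨
          A * sumTo n (λ k → n Cᴿ k * k Cᴿ j * (n ∸ k) Cᴿ j * H (n ∸ k) k)
                                                   ≈⟨ *-congˡ (trans (∑ₖnCk*kCj*[n∸k]Cj*H≈nC2j*2jCj*∑ₗ j j≤n)
                                                                     (*-congˡ (∑ₗ[n∸2j]Cl*H≈Vᵣ^[n∸2j]*Qʲ*Wₜ j 2j≤n))) ⟩
          A * (B * D * (Vˢ * (Qʲ * Wₜ)))           ≈⟨ solve 6 (λ A B D v x w → A :* (B :* D :* (v :* (x :* w))) := (A :* B) :* (D :* x :* v :* w))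
                                                          refl A B D Vˢ Qʲ Wₜ ⟩
          (A * B) * (D * Qʲ * Vˢ * Wₜ)             ≈⟨ *-congʳ (fromℕ-*-≡ ((n ℕ.+ j) C j) (n C (2 ℕ.* j)) ((n ℕ.+ j) C (2 ℕ.* j)) ((n ∸ j) C j)
                                                                          ([n+j]Cj*nC[2j]≡[n+j]C[2j]*[n∸j]Cj n j)) ⟩
          (A′ * B′) * (D * Qʲ * Vˢ * Wₜ)           ≈⟨ solve 6 (λ A B D v x w → (A :* B) :* (D :* x :* v :* w) := w :* (A :* D :* B :* x :* v))
                                                          refl A′ B′ D Vˢ Qʲ Wₜ ⟩
          Wₜ * (A′ * D * B′ * Qʲ * Vˢ)             ≈⟨ *-congˡ (*-congʳ (*-congˡ (zpow-*-+ r j))) ⟨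
          Wₜ * rhsTerm j                           ∎
          where
          A B D A′ B′ Qʲ Vˢ Wₜ : Carrier
          A  = (n ℕ.+ j) Cᴿ j
          B  = n Cᴿ (2 ℕ.* j)
          D  = (2 ℕ.* j) Cᴿ j
          A′ = (n ℕ.+ j) Cᴿ (2 ℕ.* j)
          B′ = (n ∸ j) Cᴿ j
          Qʲ = pow (zpow q qinv r) j
          Vˢ = pow (V p q qinv r) (n ∸ 2 ℕ.* j)
          Wₜ = W[ a , b ] t
        ... | no 2j≰n = begin
          sumTo n (λ k → doubleTerm j k)                  ≈⟨ *-distribˡ-sumTo n ((n ℕ.+ j) Cᴿ j) _ ⟨
          (n ℕ.+ j) Cᴿ j * sumTo n (λ k → n Cᴿ k * k Cᴿ j * (n ∸ k) Cᴿ j * H (n ∸ k) k)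
                                                          ≈⟨ *-congˡ (∑ₖnCk*kCj*[n∸k]Cj*H≈nC2j*2jCj*∑ₗ j j≤n) ⟩
          (n ℕ.+ j) Cᴿ j * (n Cᴿ (2 ℕ.* j) * (2 ℕ.* j) Cᴿ j * Σₗ)
                                                          ≈⟨ y≈0⇒x*y≈0 _ (x≈0⇒x*y≈0 Σₗ (x≈0⇒x*y≈0 _ nC2j≈0)) ⟩
          0#                                              ≈⟨ y≈0⇒x*y≈0 _ rhsTerm≈0 ⟨
          W[ a , b ] t * rhsTerm j                        ∎
          where
          Σₗ : Carrier
          Σₗ = sumTo (n ∸ j) (λ l → (n ∸ 2 ℕ.* j) Cᴿ l * H (n ∸ (j ℕ.+ l)) (j ℕ.+ l))
          nC2j≈0 : n Cᴿ (2 ℕ.* j) ≈ 0#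
          nC2j≈0 = k>n⇒nCᴿk≈0 (ℕ.≰⇒> 2j≰n)
          rhsTerm≈0 : rhsTerm j ≈ 0#
          rhsTerm≈0 = x≈0⇒x*y≈0 _ (x≈0⇒x*y≈0 _ (y≈0⇒x*y≈0 _ (k>n⇒nCᴿk≈0 (n<2j⇒n∸j<j {n} {j} (ℕ.≰⇒> 2j≰n)))))

        cubeSum≈Wₜ*rhsSum : sumTo n cubeTerm ≈ W[ a , b ] t * sumTo n rhsTerm
        cubeSum≈Wₜ*rhsSum = begin
          sumTo n cubeTerm                                    ≈⟨ sumTo-cong≤ n cubeTerm≈∑ⱼdoubleTerm ⟩
          sumTo n (λ k → sumTo n (λ j → doubleTerm j k))      ≈⟨ sumTo-comm n n _ ⟩
          sumTo n (λ j → sumTo n (λ k → doubleTerm j k))      ≈⟨ sumTo-cong≤ n ∑ₖdoubleTerm≈Wₜ*rhsTerm ⟩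
          sumTo n (λ j → W[ a , b ] t * rhsTerm j)            ≈⟨ *-distribˡ-sumTo n _ _ ⟨
          W[ a , b ] t * sumTo n rhsTerm                      ∎

theorem59 : ∀ {c ℓ : Level} (R : CommutativeRing c ℓ) →
    let open CommutativeRing R
        open Horadam R
    in (a b p q qinv : Carrier) → ¬ (p ≈ 0#) → ¬ (q ≈ 0#) → q * qinv ≈ 1# →
       (n : ℕ) (r t : ℤ) →
       sumTo n (λ k → pow (fromℕ (n C k)) 3
                      * zpow q qinv (r ℤ.* + k)
                      * W a b p q qinv (r ℤ.* (+ n ℤ.- + (2 ℕ.* k)) ℤ.+ t))
       ≈ W a b p q qinv t
         * sumTo n (λ k → fromℕ ((n ℕ.+ k) C (2 ℕ.* k))
                          * fromℕ ((2 ℕ.* k) C k)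
                          * fromℕ ((n ∸ k) C k)
                          * zpow q qinv (r ℤ.* + k)
                          * pow (V p q qinv r) (n ∸ 2 ℕ.* k))
theorem59 R a b p q qinv _ _ q*qinv≈1 n r t = cubeSum≈Wₜ*rhsSum R p q qinv q*qinv≈1 a b r t n
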